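{- Over the class of euclidean frames, $\smile\varphi,\smile\smile\varphi\models$ and $\models\frown\frown\varphi,\frown\varphi$. Over the class of serial transitive frames, $\models\smile\smile\varphi,\smile\varphi$ and $\frown\varphi,\frown\frown\varphi\models$.
   Context: Kripke models; $\mathcal{M},w\Vdash\smile\varphi$ iff $\varphi$ fails at some $R$-successor of $w$; $\mathcal{M},w\Vdash\frown\varphi$ iff $\varphi$ fails at every $R$-successor of $w$. A consecution $\Gamma\models\Delta$ holds over a class if at every world of every model on a frame of the class some member of $\Gamma$ fails or some member of $\Delta$ holds (empty sides allowed). -}

module Defs where

open import Data.Nat using (ℕ)
open import Data.Product using (Σ; _×_; ∃-syntax)
open import Data.List using (List; []; _∷_)
open import Data.List.Relation.Unary.All using (All)
open import Relation.Nullary using (¬_)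

data Fm : Set where
  var      : ℕ → Fm
  ⊤′ ⊥′    : Fm
  _∧′_ _∨′_ _⇒′_ : Fm → Fm → Fm
  ⌣_ ⌢_    : Fm → Fm

record Frame : Set₁ where
  field
    W : Set
    R : W → W → Set

record Model : Set₁ where
  field
    frame : Frame
    V     : ℕ → Frame.W frame → Set
  open Frame frame public

open Model

_,_⊩_ : (M : Model) → W M → Fm → Set
M , w ⊩ var p   = V M p w
M , w ⊩ ⊤′      = Data.Unit.⊤ where import Data.Unit
M , w ⊩ ⊥′      = Data.Empty.⊥ where import Data.Empty
M , w ⊩ (φ ∧′ ψ) = (M , w ⊩ φ) × (M , w ⊩ ψ)
M , w ⊩ (φ ∨′ ψ) = (M , w ⊩ φ) Data.Sum.⊎ (M , w ⊩ ψ) where import Data.Sum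
M , w ⊩ (φ ⇒′ ψ) = (M , w ⊩ φ) → (M , w ⊩ ψ)
M , w ⊩ (⌣ φ)   = ∃[ v ] (R M w v × ¬ (M , v ⊩ φ))
M , w ⊩ (⌢ φ)   = ∀ v → R M w v → ¬ (M , v ⊩ φ)

Euclidean : Frame → Set
Euclidean F = ∀ {w u v} → Frame.R F w u → Frame.R F w v → Frame.R F u v

Serial : Frame → Set
Serial F = ∀ w → ∃[ v ] Frame.R F w v

Transitive : Frame → Set
Transitive F = ∀ {w u v} → Frame.R F w u → Frame.R F u v → Frame.R F w v

SerialTransitive : Frame → Set
SerialTransitive F = Serial F × Transitive F

-- Consecution Γ ⊨ Δ over a class C of frames: at every world of every model
-- on a frame of C it is not the case that all of Γ hold and all of Δ fail
-- (classically: some member of Γ fails or some member of Δ holds).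
Valid⟨_⟩ : (Frame → Set) → List Fm → List Fm → Set₁
Valid⟨ C ⟩ Γ Δ = (M : Model) → C (frame M) → (w : W M) →
  ¬ (All (λ γ → M , w ⊩ γ) Γ × All (λ δ → ¬ (M , w ⊩ δ)) Δ)

-- In a euclidean frame every successor of w sees everything w sees, so
-- "φ fails at some successor" (⌣φ) and "φ holds at some successor" (¬⌢φ)
-- pass from w to all its successors; then ⌣φ forces ⌢⌣φ and ¬⌢φ forces ⌢⌢φ.
-- In a transitive frame w sees everything its successors see, so ⌢φ and
-- ¬⌣φ pass to all successors, and seriality supplies a successor at which
-- the propagated fact contradicts ⌢⌢φ, respectively witnesses ⌣⌣φ.
module Submission where

open import Defs
open import Data.Product using (_×_; _,_)
open import Data.List using ([]; _∷_)
open import Data.List.Relation.Unary.All using ([]; _∷_)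
open import Relation.Nullary using (¬_)

open Model

module _ (M : Model) where

  ⌣-euclidean : Euclidean (frame M) → ∀ {w u} φ →
    M , w ⊩ (⌣ φ) → R M w u → M , u ⊩ (⌣ φ)
  ⌣-euclidean euclid φ (v , wRv , v⊮φ) wRu = v , euclid wRu wRv , v⊮φ

  ¬⌢-euclidean : Euclidean (frame M) → ∀ {w u} φ →
    ¬ (M , w ⊩ (⌢ φ)) → R M w u → ¬ (M , u ⊩ (⌢ φ))
  ¬⌢-euclidean euclid φ w⊮⌢φ wRu u⊩⌢φ =
    w⊮⌢φ λ v wRv → u⊩⌢φ v (euclid wRu wRv)

  ⌢-transitive : Transitive (frame M) → ∀ {w u} φ →
    M , w ⊩ (⌢ φ) → R M w u → M , u ⊩ (⌢ φ)
  ⌢-transitive trans φ w⊩⌢φ wRu v uRv = w⊩⌢φ v (trans wRu uRv)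

  ¬⌣-transitive : Transitive (frame M) → ∀ {w u} φ →
    ¬ (M , w ⊩ (⌣ φ)) → R M w u → ¬ (M , u ⊩ (⌣ φ))
  ¬⌣-transitive trans φ w⊮⌣φ wRu (v , uRv , v⊮φ) = w⊮⌣φ (v , trans wRu uRv , v⊮φ)

  ⌢⇒⌣-serial : Serial (frame M) → ∀ {w} φ → M , w ⊩ (⌢ φ) → M , w ⊩ (⌣ φ)
  ⌢⇒⌣-serial serial {w} φ w⊩⌢φ with serial w
  ... | v , wRv = v , wRv , w⊩⌢φ v wRv

⌣,⌣⌣⊨-euclidean : ∀ φ → Valid⟨ Euclidean ⟩ (⌣ φ ∷ ⌣ ⌣ φ ∷ []) []
⌣,⌣⌣⊨-euclidean φ M euclid w ((w⊩⌣φ ∷ (u , wRu , u⊮⌣φ) ∷ []) , []) =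
  u⊮⌣φ (⌣-euclidean M euclid φ w⊩⌣φ wRu)

⊨⌢⌢,⌢-euclidean : ∀ φ → Valid⟨ Euclidean ⟩ [] (⌢ ⌢ φ ∷ ⌢ φ ∷ [])
⊨⌢⌢,⌢-euclidean φ M euclid w ([] , (w⊮⌢⌢φ ∷ w⊮⌢φ ∷ [])) =
  w⊮⌢⌢φ λ u wRu → ¬⌢-euclidean M euclid φ w⊮⌢φ wRu

⊨⌣⌣,⌣-serialTransitive : ∀ φ → Valid⟨ SerialTransitive ⟩ [] (⌣ ⌣ φ ∷ ⌣ φ ∷ [])
⊨⌣⌣,⌣-serialTransitive φ M (serial , trans) w ([] , (w⊮⌣⌣φ ∷ w⊮⌣φ ∷ [])) =
  w⊮⌣⌣φ (⌢⇒⌣-serial M serial (⌣ φ) λ u wRu → ¬⌣-transitive M trans φ w⊮⌣φ wRu)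

⌢,⌢⌢⊨-serialTransitive : ∀ φ → Valid⟨ SerialTransitive ⟩ (⌢ φ ∷ ⌢ ⌢ φ ∷ []) []
⌢,⌢⌢⊨-serialTransitive φ M (serial , trans) w ((w⊩⌢φ ∷ w⊩⌢⌢φ ∷ []) , [])
  with ⌢⇒⌣-serial M serial (⌢ φ) w⊩⌢⌢φ
... | u , wRu , u⊮⌢φ = u⊮⌢φ (⌢-transitive M trans φ w⊩⌢φ wRu)

mainTheorem18 : (φ : Fm) →
    (Valid⟨ Euclidean ⟩ (⌣ φ ∷ ⌣ ⌣ φ ∷ []) []
    × Valid⟨ Euclidean ⟩ [] (⌢ ⌢ φ ∷ ⌢ φ ∷ []))
    × (Valid⟨ SerialTransitive ⟩ [] (⌣ ⌣ φ ∷ ⌣ φ ∷ [])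
    × Valid⟨ SerialTransitive ⟩ (⌢ φ ∷ ⌢ ⌢ φ ∷ []) [])
mainTheorem18 φ =
  (⌣,⌣⌣⊨-euclidean φ , ⊨⌢⌢,⌢-euclidean φ) ,
  (⊨⌣⌣,⌣-serialTransitive φ , ⌢,⌢⌢⊨-serialTransitive φ)
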